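{- Let $\mathscr{R}$ be a ring and $U$ a finite set with $n$ elements. Given, for each $i\in U$, a function $f_i\colon 2^U\to\mathscr{R}$, the multi-subset transform $g\colon 2^U\to\mathscr{R}$ of $(f_i)_{i\in U}$, defined by $$g(T)=\sum_{S\subseteq T}\ \prod_{i\in T} f_i(S),\qquad T\subseteq U,$$ can be computed using $O(2.985^n)$ arithmetic operations.
   Context: $2^U$ denotes the family of all subsets of $U$. Arithmetic operations are additions (subtractions) and multiplications in the ring $\mathscr{R}$; the input consists of the values $f_i(S)$ for all $i\in U$, $S\subseteq U$, and the output consists of the values $g(T)$ for all $T\subseteq U$. -}

module Defs where

open import Level using (Level)
open import Algebra.Bundles using (CommutativeRing)
open import Data.Nat using (ℕ; zero; suc) renaming (_+_ to _+ℕ_)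
open import Data.Fin using (Fin; zero; suc)
open import Data.Fin.Subset using (Subset)
open import Data.Vec using (Vec; []; _∷_)
open import Data.Bool using (Bool; true; false)
open import Data.List using (List; []; _∷_; map; _++_; foldr)

subsetsOf : ∀ {n} → Subset n → List (Subset n)
subsetsOf [] = [] ∷ []
subsetsOf (true ∷ T) = map (false ∷_) (subsetsOf T) ++ map (true ∷_) (subsetsOf T)
subsetsOf (false ∷ T) = map (false ∷_) (subsetsOf T)

-- A gate added when k gates exist may reference
-- earlier gates by Fin k (zero = most recently added gate).
data Gate (n k : ℕ) : Set where
  input : Fin n → Subset n → Gate n k
  const0 const1 : Gate n k
  add sub mul : Fin k → Fin k → Gate n k

data Prog (n : ℕ) : ℕ → Set where
  []  : Prog n 0
  _▷_ : ∀ {k} → Prog n k → Gate n k → Prog n (suc k)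

gateCost : ∀ {n k} → Gate n k → ℕ
gateCost (add _ _) = 1
gateCost (sub _ _) = 1
gateCost (mul _ _) = 1
gateCost _ = 0

cost : ∀ {n k} → Prog n k → ℕ
cost [] = 0
cost (p ▷ g) = gateCost g +ℕ cost p

module Semantics {c ℓ : Level} (R : CommutativeRing c ℓ) where
  open CommutativeRing R using (Carrier; _≈_; _+_; _-_; _*_; 0#; 1#)

  evalGate : ∀ {n k} → Gate n k → (Fin n → Subset n → Carrier) → (Fin k → Carrier) → Carrier
  evalGate (input i S) f v = f i S
  evalGate const0 f v = 0#
  evalGate const1 f v = 1#
  evalGate (add a b) f v = v a + v b
  evalGate (sub a b) f v = v a - v b
  evalGate (mul a b) f v = v a * v b

  eval : ∀ {n k} → Prog n k → (Fin n → Subset n → Carrier) → Fin k → Carrier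
  eval (p ▷ g) f zero = evalGate g f (eval p f)
  eval (p ▷ g) f (suc j) = eval p f j

  sumList : List Carrier → Carrier
  sumList = foldr _+_ 0#

  prodOver : ∀ {n} → Subset n → (Fin n → Carrier) → Carrier
  prodOver [] h = 1#
  prodOver (true ∷ T) h = h zero * prodOver T (λ i → h (suc i))
  prodOver (false ∷ T) h = prodOver T (λ i → h (suc i))

  multiSubsetTransform : ∀ {n} → (Fin n → Subset n → Carrier) → Subset n → Carrier
  multiSubsetTransform f T = sumList (map (λ S → prodOver T (λ i → f i S)) (subsetsOf T))

  Computes : ∀ {n k} → Prog n k → (Subset n → Fin k) → Set (c Level.⊔ ℓ)
  Computes p out = ∀ f T → eval p f (out T) ≈ multiSubsetTransform f T

module Submission where

-- Cut the ground set into m blocks of three coordinates and r ≤ 2 remaining ones,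
-- n = 3m + r.  For S ⊆ T the product ∏_{i ∈ T} f_i(S) is X(x) · Y(y), where the X side
-- takes coordinates 1, 2 of every block and the r remaining ones, the Y side coordinate 3
-- of every block, and x (resp. y) records S everywhere and T on the X (resp. Y) side.
-- Thus g = Bil m X Y for a bilinear form Bil m that is a sum over blocks.  On one block
-- it is a sum of 27 products, one per (s , t) ∈ {00, 01, 11}³; 19 of them are used as
-- they are, and the remaining 8 form a 2 × 2 matrix product, done with Strassen's 7.
-- Recursing on the 26 terms costs O(26^m · n) = O(2.9625^n) operations.

open import Level using (Level; _⊔_)
open import Algebra.Bundles using (CommutativeRing)
open import Data.Nat using (ℕ)
open import Defs
module FiniteIndex where

  open import Data.Nat using (ℕ; zero; suc) renaming (_+_ to _+ℕ_; _*_ to _*ℕ_)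
  open import Data.Fin using (Fin)
  open import Data.Vec using (Vec)
  open import Data.Bool using (Bool)
  open import Data.Product using (_×_)
  open import Data.Sum using (_⊎_)

  data St : Set where
    s00 s01 s11 : St

  -- Codes for the finite index sets used to label gates, with their cardinalities;
  -- a family of circuits indexed by  El c  costs  card c  times one member.
  infixr 7 _⊗_
  infixr 6 _⊕c_
  data Code : Set where
    bool st3 : Code
    fin : ℕ → Code
    _⊗_ _⊕c_ : Code → Code → Code
    vec : Code → ℕ → Code

  El : Code → Set
  El bool = Bool
  El st3 = St
  El (fin k) = Fin k
  El (a ⊗ b) = El a × El b
  El (a ⊕c b) = El a ⊎ El b
  El (vec a k) = Vec (El a) k

  card : Code → ℕ
  card bool = 2
  card st3 = 3
  card (fin k) = k
  card (a ⊗ b) = card a *ℕ card b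
  card (a ⊕c b) = card a +ℕ card b
  card (vec a zero) = 1
  card (vec a (suc k)) = card a *ℕ card (vec a k)


-- A  Circuit I O κ  takes any program
-- that already holds values indexed by I and extends it by gates of total cost ≤ κ that
-- compute the outputs O, whose values are given by its specification  spec.
module Circuits {c ℓ : Level} (R : CommutativeRing c ℓ) (n : ℕ) where

  open CommutativeRing R hiding (zero)
  open Semantics R using (eval)
  open import Data.Nat using (ℕ; zero; suc; _≤_; s≤s) renaming (_+_ to _+ℕ_; _*_ to _*ℕ_)
  import Data.Nat.Properties as ℕₚ
  open import Data.Fin using (Fin; zero; suc)
  open import Data.Fin.Subset using (Subset)
  open import Data.Vec using ([]; _∷_)
  open import Data.Bool using (false; true)
  open import Data.Product using (_×_; _,_; proj₁; proj₂)
  open import Data.Sum using (_⊎_; inj₁; inj₂)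
  open import Data.Unit using (⊤; tt)
  open import Data.Empty using (⊥; ⊥-elim)
  open import Function using (_∘_; id)
  open import Relation.Binary.PropositionalEquality as P using (_≡_)
  open FiniteIndex

  Input : Set c
  Input = Fin n → Subset n → Carrier

  data Op : Set where
    plus minus times : Op

  ⟦_⟧op : Op → Carrier → Carrier → Carrier
  ⟦ plus ⟧op = _+_
  ⟦ minus ⟧op = _-_
  ⟦ times ⟧op = _*_

  ⟦⟧op-cong : ∀ o {x x' y y'} → x ≈ x' → y ≈ y' → ⟦ o ⟧op x y ≈ ⟦ o ⟧op x' y'
  ⟦⟧op-cong plus ex ey = +-cong ex ey
  ⟦⟧op-cong minus ex ey = +-cong ex (-‿cong ey)
  ⟦⟧op-cong times ex ey = *-cong ex ey

  gate : ∀ {k} → Op → Fin k → Fin k → Gate n k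
  gate plus = add
  gate minus = sub
  gate times = mul

  gate-cost : ∀ o {k} (a b : Fin k) → gateCost (gate o a b) ≡ 1
  gate-cost plus a b = P.refl
  gate-cost minus a b = P.refl
  gate-cost times a b = P.refl

  gate-eval : ∀ o {k} (a b : Fin k) f (v : Fin k → Carrier) →
              Semantics.evalGate R (gate o a b) f v ≡ ⟦ o ⟧op (v a) (v b)
  gate-eval plus a b f v = P.refl
  gate-eval minus a b f v = P.refl
  gate-eval times a b f v = P.refl

  data Expr (I : Set) : Set where
    leaf : I → Expr I
    inp : Fin n → Subset n → Expr I
    oneE : Expr I
    bin : Op → Expr I → Expr I → Expr I

  infixl 6 _⊕_ _⊖_
  infixl 7 _⊛_
  pattern _⊕_ a b = bin plus a b
  pattern _⊖_ a b = bin minus a b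
  pattern _⊛_ a b = bin times a b

  ⟦_⟧ : ∀ {I} → Expr I → Input → (I → Carrier) → Carrier
  ⟦ leaf i ⟧ f v = v i
  ⟦ inp i S ⟧ f v = f i S
  ⟦ oneE ⟧ f v = 1#
  ⟦ bin o a b ⟧ f v = ⟦ o ⟧op (⟦ a ⟧ f v) (⟦ b ⟧ f v)

  size : ∀ {I} → Expr I → ℕ
  size (bin o a b) = suc (size a +ℕ size b)
  size _ = 0

  ⟦⟧-cong : ∀ {I} (e : Expr I) f {u v : I → Carrier} → (∀ i → u i ≈ v i) → ⟦ e ⟧ f u ≈ ⟦ e ⟧ f v
  ⟦⟧-cong (leaf i) f h = h i
  ⟦⟧-cong (inp i S) f h = refl
  ⟦⟧-cong oneE f h = refl
  ⟦⟧-cong (bin o a b) f h = ⟦⟧op-cong o (⟦⟧-cong a f h) (⟦⟧-cong b f h)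

  record Extension {k} (p : Prog n k) (O : Set) (κ : ℕ) : Set c where
    constructor extension
    field
      {width} : ℕ
      prog : Prog n width
      lift : Fin k → Fin width
      lift-eval : ∀ f j → eval prog f (lift j) ≡ eval p f j
      output : O → Fin width
      cost-le : cost prog ≤ κ +ℕ cost p
  open Extension public

  record Circuit (I O : Set) (κ : ℕ) : Set (c ⊔ ℓ) where
    field
      spec : Input → (I → Carrier) → O → Carrier
      extend : ∀ {k} (p : Prog n k) → (I → Fin k) → Extension p O κ
      sound : ∀ {k} (p : Prog n k) (ins : I → Fin k) f (v : I → Carrier) →
              (∀ i → eval p f (ins i) ≈ v i) →
              ∀ o → eval (prog (extend p ins)) f (output (extend p ins) o) ≈ spec f v o
  open Circuit public

  withOutput : ∀ {k O O' κ} {p : Prog n k} (r : Extension p O κ) → (O' → Fin (width r)) → Extension p O' κ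
  withOutput r out = extension (prog r) (lift r) (lift-eval r) out (cost-le r)

  cost-compose : ∀ {a b x y z} → y ≤ a +ℕ x → z ≤ b +ℕ y → z ≤ (a +ℕ b) +ℕ x
  cost-compose {a} {b} {x} h1 h2 = ℕₚ.≤-trans h2 (ℕₚ.≤-trans (ℕₚ.+-monoʳ-≤ b h1)
    (ℕₚ.≤-reflexive (P.trans (P.sym (ℕₚ.+-assoc b a x)) (P.cong (_+ℕ x) (ℕₚ.+-comm b a)))))

  _then_ : ∀ {k κ₁ κ₂ O O'} {p : Prog n k} (r : Extension p O κ₁) → Extension (prog r) O' κ₂ → Extension p O' (κ₁ +ℕ κ₂)
  _then_ {κ₁ = κ₁} {κ₂} {p = p} r r' =
    extension (prog r') (lift r' ∘ lift r) (λ f j → P.trans (lift-eval r' f (lift r j)) (lift-eval r f j))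
              (output r') (cost-compose {κ₁} {κ₂} {cost p} (cost-le r) (cost-le r'))

  seq : ∀ {I M O κ₁ κ₂} → Circuit I M κ₁ → Circuit M O κ₂ → Circuit I O (κ₁ +ℕ κ₂)
  spec (seq A B) f v = spec B f (spec A f v)
  extend (seq A B) p ins = let r = extend A p ins in r then extend B (prog r) (output r)
  sound (seq A B) p ins f v h = let r = extend A p ins in sound B (prog r) (output r) f (spec A f v) (sound A p ins f v h)

  both : ∀ {I O₁ O₂ κ₁ κ₂} → Circuit I O₁ κ₁ → Circuit I O₂ κ₂ → Circuit I (O₁ ⊎ O₂) (κ₁ +ℕ κ₂)
  spec (both A B) f v (inj₁ o) = spec A f v o
  spec (both A B) f v (inj₂ o) = spec B f v o
  extend (both A B) p ins =
    let r = extend A p ins ; r' = extend B (prog r) (lift r ∘ ins) ; e = r then r' in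
    withOutput e (λ { (inj₁ o) → lift r' (output r o) ; (inj₂ o) → output r' o })
  sound (both A B) p ins f v h (inj₁ o) =
    let r = extend A p ins in
    trans (reflexive (lift-eval (extend B (prog r) (lift r ∘ ins)) f (output r o))) (sound A p ins f v h o)
  sound (both A B) p ins f v h (inj₂ o) =
    let r = extend A p ins in
    sound B (prog r) (lift r ∘ ins) f v (λ i → trans (reflexive (lift-eval r f (ins i))) (h i)) o

  reindexIn : ∀ {I I' O κ} → (I → I') → Circuit I O κ → Circuit I' O κ
  spec (reindexIn g A) f v = spec A f (v ∘ g)
  extend (reindexIn g A) p ins = extend A p (ins ∘ g)
  sound (reindexIn g A) p ins f v h = sound A p (ins ∘ g) f (v ∘ g) (h ∘ g)

  reindexOut : ∀ {I O O' κ} → (O' → O) → Circuit I O κ → Circuit I O' κ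
  spec (reindexOut g A) f v = spec A f v ∘ g
  extend (reindexOut g A) p ins = let r = extend A p ins in withOutput r (output r ∘ g)
  sound (reindexOut g A) p ins f v h o = sound A p ins f v h (g o)

  relax : ∀ {I O κ κ'} → κ ≤ κ' → Circuit I O κ → Circuit I O κ'
  spec (relax le A) = spec A
  extend (relax le A) p ins = let r = extend A p ins in
    extension (prog r) (lift r) (lift-eval r) (output r) (ℕₚ.≤-trans (cost-le r) (ℕₚ.+-monoˡ-≤ _ le))
  sound (relax le A) = sound A

  relax≡ : ∀ {I O κ κ'} → κ ≡ κ' → Circuit I O κ → Circuit I O κ'
  relax≡ e = relax (ℕₚ.≤-reflexive e)

  respec : ∀ {I O κ} (A : Circuit I O κ) (Ψ : Input → (I → Carrier) → O → Carrier) →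
           (∀ f v o → spec A f v o ≈ Ψ f v o) → Circuit I O κ
  spec (respec A Ψ eq) = Ψ
  extend (respec A Ψ eq) = extend A
  sound (respec A Ψ eq) p ins f v h o = trans (sound A p ins f v h o) (eq f v o)

  empty : ∀ {I O} → (O → ⊥) → Circuit I O 0
  spec (empty e) f v o = ⊥-elim (e o)
  extend (empty e) p ins = extension p id (λ f j → P.refl) (λ o → ⊥-elim (e o)) ℕₚ.≤-refl
  sound (empty e) p ins f v h o = ⊥-elim (e o)

  free : ∀ {k} (p : Prog n k) (g : Gate n k) → gateCost g ≡ 0 → Extension p ⊤ 0
  free p g z = extension (p ▷ g) suc (λ f j → P.refl) (λ _ → zero) (ℕₚ.≤-reflexive (P.cong (_+ℕ cost p) z))

  compileExt : ∀ {I k} (e : Expr I) (p : Prog n k) → (I → Fin k) → Extension p ⊤ (size e)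
  compileExt (leaf i) p ins = extension p id (λ f j → P.refl) (λ _ → ins i) ℕₚ.≤-refl
  compileExt (inp i S) p ins = free p (input i S) P.refl
  compileExt oneE p ins = free p const1 P.refl
  compileExt (bin o a b) p ins =
    let ra = compileExt a p ins ; rb = compileExt b (prog ra) (lift ra ∘ ins) ; r = ra then rb in
    extension (prog rb ▷ gate o (lift rb (output ra tt)) (output rb tt)) (suc ∘ lift r) (lift-eval r) (λ _ → zero)
      (P.subst (λ q → q +ℕ cost (prog rb) ≤ suc (size a +ℕ size b) +ℕ cost p) (P.sym (gate-cost o _ _))
        (s≤s (cost-le r)))

  compile-eval : ∀ {I k} (e : Expr I) (p : Prog n k) (ins : I → Fin k) f (u : I → Carrier) →
    (∀ i → eval p f (ins i) ≡ u i) → eval (prog (compileExt e p ins)) f (output (compileExt e p ins) tt) ≡ ⟦ e ⟧ f u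
  compile-eval (leaf i) p ins f u h = h i
  compile-eval (inp i S) p ins f u h = P.refl
  compile-eval oneE p ins f u h = P.refl
  compile-eval (bin o a b) p ins f u h =
    let ra = compileExt a p ins ; rb = compileExt b (prog ra) (lift ra ∘ ins) in
    P.trans (gate-eval o _ _ f (eval (prog rb) f))
      (P.cong₂ ⟦ o ⟧op (P.trans (lift-eval rb f (output ra tt)) (compile-eval a p ins f u h))
                       (compile-eval b (prog ra) (lift ra ∘ ins) f u (λ i → P.trans (lift-eval ra f (ins i)) (h i))))

  compile : ∀ {I} (e : Expr I) → Circuit I ⊤ (size e)
  spec (compile e) f v _ = ⟦ e ⟧ f v
  extend (compile e) = compileExt e
  sound (compile e) p ins f v h tt =
    trans (reflexive (compile-eval e p ins f (λ i → eval p f (ins i)) (λ i → P.refl))) (⟦⟧-cong e f h)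

  familySpec : ∀ {A' I O : Set} {κ} → (A' → Circuit I O κ) → Input → (I → Carrier) → A' × O → Carrier
  familySpec A f v xo = spec (A (proj₁ xo)) f v (proj₂ xo)

  family : ∀ (c : Code) {I O κ} (A : El c → Circuit I O κ) → Circuit I (El c × O) (card c *ℕ κ)
  familyCore : ∀ (c : Code) {I O κ} (A : El c → Circuit I O κ) → Circuit I (El c × O) (card c *ℕ κ)
  familyCore-spec : ∀ (c : Code) {I O κ} (A : El c → Circuit I O κ) f v xo →
                    spec (familyCore c A) f v xo ≈ familySpec A f v xo

  family c A = respec (familyCore c A) (familySpec A) (familyCore-spec c A)

  familyCore bool {κ = κ} A =
    relax≡ (P.cong (κ +ℕ_) (P.sym (ℕₚ.+-identityʳ κ)))
      (reindexOut (λ { (false , o) → inj₁ o ; (true , o) → inj₂ o }) (both (A false) (A true)))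
  familyCore st3 {κ = κ} A =
    relax≡ (P.cong (λ q → κ +ℕ (κ +ℕ q)) (P.sym (ℕₚ.+-identityʳ κ)))
      (reindexOut (λ { (s00 , o) → inj₁ o ; (s01 , o) → inj₂ (inj₁ o) ; (s11 , o) → inj₂ (inj₂ o) })
        (both (A s00) (both (A s01) (A s11))))
  familyCore (fin zero) A = empty (λ { (() , _) })
  familyCore (fin (suc k)) A =
    reindexOut (λ { (zero , o) → inj₁ o ; (suc j , o) → inj₂ (j , o) }) (both (A zero) (family (fin k) (A ∘ suc)))
  familyCore (a ⊗ b) {κ = κ} A =
    relax≡ (P.sym (ℕₚ.*-assoc (card a) (card b) κ))
      (reindexOut (λ { ((x , y) , o) → (x , (y , o)) }) (family a (λ x → family b (λ y → A (x , y)))))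
  familyCore (a ⊕c b) {κ = κ} A =
    relax≡ (P.sym (ℕₚ.*-distribʳ-+ κ (card a) (card b)))
      (reindexOut (λ { (inj₁ x , o) → inj₁ (x , o) ; (inj₂ y , o) → inj₂ (y , o) })
        (both (family a (A ∘ inj₁)) (family b (A ∘ inj₂))))
  familyCore (vec a zero) {κ = κ} A = relax≡ (P.sym (ℕₚ.+-identityʳ κ)) (reindexOut proj₂ (A []))
  familyCore (vec a (suc k)) {κ = κ} A =
    relax≡ (P.sym (ℕₚ.*-assoc (card a) (card (vec a k)) κ))
      (reindexOut (λ { ((x ∷ xs) , o) → (x , (xs , o)) }) (family a (λ x → family (vec a k) (λ xs → A (x ∷ xs)))))

  familyCore-spec bool A f v (false , o) = refl
  familyCore-spec bool A f v (true , o) = refl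
  familyCore-spec st3 A f v (s00 , o) = refl
  familyCore-spec st3 A f v (s01 , o) = refl
  familyCore-spec st3 A f v (s11 , o) = refl
  familyCore-spec (fin (suc k)) A f v (zero , o) = refl
  familyCore-spec (fin (suc k)) A f v (suc j , o) = refl
  familyCore-spec (a ⊗ b) A f v ((x , y) , o) = refl
  familyCore-spec (a ⊕c b) A f v (inj₁ x , o) = refl
  familyCore-spec (a ⊕c b) A f v (inj₂ y , o) = refl
  familyCore-spec (vec a zero) A f v ([] , o) = refl
  familyCore-spec (vec a (suc k)) A f v ((x ∷ xs) , o) = refl

  layer : ∀ (c : Code) {I} (E : El c → Expr I) (s : ℕ) → (∀ x → size (E x) ≤ s) → Circuit I (El c) (card c *ℕ s)
  layer c E s bd = reindexOut (λ x → (x , tt)) (family c (λ x → relax (bd x) (compile (E x))))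

module Splitting where

  open import Data.Nat using (ℕ; zero; suc; _^_) renaming (_+_ to _+ℕ_; _*_ to _*ℕ_)
  open import Data.Vec using (Vec; []; _∷_; replicate)
  open import Data.Bool using (Bool; true; false; _≤_; f≤t; b≤b)
  open import Data.Product using (_,_)
  open import Data.Sum using (inj₁; inj₂)
  open import Relation.Binary.PropositionalEquality as P using (_≡_)
  open FiniteIndex

  data _⊆ᵥ_ : ∀ {k} → Vec Bool k → Vec Bool k → Set where
    []ᵥ : [] ⊆ᵥ []
    _∷ᵥ_ : ∀ {k s t} {S T : Vec Bool k} → s ≤ t → S ⊆ᵥ T → (s ∷ S) ⊆ᵥ (t ∷ T)

  data Merge : ∀ {k} → Vec Bool k → Vec Bool k → Vec Bool k → Set where
    mnil : Merge [] [] []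
    mff : ∀ {k} {A B T : Vec Bool k} → Merge A B T → Merge (false ∷ A) (false ∷ B) (false ∷ T)
    mtf : ∀ {k} {A B T : Vec Bool k} → Merge A B T → Merge (true ∷ A) (false ∷ B) (true ∷ T)
    mft : ∀ {k} {A B T : Vec Bool k} → Merge A B T → Merge (false ∷ A) (true ∷ B) (true ∷ T)

  st : Bool → Bool → St
  st false false = s00
  st false true = s01
  st true _ = s11

  sOf tOf : St → Bool
  sOf s00 = false
  sOf s01 = false
  sOf s11 = true
  tOf s00 = false
  tOf s01 = true
  tOf s11 = true

  sOf-st : ∀ s t → sOf (st s t) ≡ s
  sOf-st false false = P.refl
  sOf-st false true = P.refl
  sOf-st true t = P.refl

  sts : ∀ {k} → Vec Bool k → Vec Bool k → Vec St k
  sts [] [] = []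
  sts (s ∷ S) (t ∷ T) = st s t ∷ sts S T

  tOfs sOfs : ∀ {k} → Vec St k → Vec Bool k
  tOfs [] = []
  tOfs (σ ∷ σs) = tOf σ ∷ tOfs σs
  sOfs [] = []
  sOfs (σ ∷ σs) = sOf σ ∷ sOfs σs

  sOfs-sts : ∀ {k} (S T : Vec Bool k) → sOfs (sts S T) ≡ S
  sOfs-sts [] [] = P.refl
  sOfs-sts (s ∷ S) (t ∷ T) = P.cong₂ _∷_ (sOf-st s t) (sOfs-sts S T)

  merge-X : ∀ {k s t} {A B T : Vec Bool k} → s ≤ t → Merge A B T → Merge (tOf (st s t) ∷ A) (false ∷ B) (t ∷ T)
  merge-X f≤t mg = mtf mg
  merge-X (b≤b {false}) mg = mff mg
  merge-X (b≤b {true}) mg = mtf mg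

  merge-Y : ∀ {k s t} {A B T : Vec Bool k} → s ≤ t → Merge A B T → Merge (false ∷ A) (tOf (st s t) ∷ B) (t ∷ T)
  merge-Y f≤t mg = mft mg
  merge-Y (b≤b {false}) mg = mff mg
  merge-Y (b≤b {true}) mg = mft mg

  merge-allX : ∀ {k} (S T : Vec Bool k) → S ⊆ᵥ T → Merge (tOfs (sts S T)) (replicate k false) T
  merge-allX [] [] []ᵥ = mnil
  merge-allX (s ∷ S) (t ∷ T) (le ∷ᵥ h) = merge-X le (merge-allX S T h)

  -- The X side sees the full state (s , t) of
  -- coordinates 1, 2 but only s of coordinate 3; the Y side sees s of coordinates
  -- 1, 2 and the full state of coordinate 3; the output is indexed by t.
  XBlock YBlock ZBlock : Code
  XBlock = st3 ⊗ st3 ⊗ bool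
  YBlock = bool ⊗ bool ⊗ st3
  ZBlock = bool ⊗ bool ⊗ bool

  -- The 26 bilinear terms into which one block of the form decomposes, sorted by
  -- the bits (s1 , s3) of S on the outer coordinates: 4 + 6 + 6 + 3 terms that are
  -- single products, and Strassen's 7 products for the case s1 = s3 = 0, t2 = 1,
  -- where the sum over s2 is a 2 × 2 matrix product indexed by (t1 , s2 , t3).
  Terms : Code
  Terms = (bool ⊗ bool) ⊕c (bool ⊗ st3) ⊕c (bool ⊗ st3) ⊕c st3 ⊕c fin 7

  pattern term00 t1 t3 = inj₁ (t1 , t3)
  pattern term10 t3 σ = inj₂ (inj₁ (t3 , σ))
  pattern term01 t1 σ = inj₂ (inj₂ (inj₁ (t1 , σ)))
  pattern term11 σ = inj₂ (inj₂ (inj₂ (inj₁ σ)))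
  pattern termS j = inj₂ (inj₂ (inj₂ (inj₂ j)))

  -- The ground set has m blocks followed by r remaining coordinates, which are
  -- all put on the X side.
  module Levels (r : ℕ) where

    dim : ℕ → ℕ
    dim m = m *ℕ 3 +ℕ r

    XIndex YIndex ZIndex : ℕ → Code
    XIndex zero = vec st3 r
    XIndex (suc m) = XBlock ⊗ XIndex m
    YIndex zero = vec bool r
    YIndex (suc m) = YBlock ⊗ YIndex m
    ZIndex zero = vec bool r
    ZIndex (suc m) = ZBlock ⊗ ZIndex m

    TX SX : ∀ m → El (XIndex m) → Vec Bool (dim m)
    TX zero σs = tOfs σs
    TX (suc m) ((σ1 , σ2 , s3) , x) = tOf σ1 ∷ tOf σ2 ∷ false ∷ TX m x
    SX zero σs = sOfs σs
    SX (suc m) ((σ1 , σ2 , s3) , x) = sOf σ1 ∷ sOf σ2 ∷ s3 ∷ SX m x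

    TY SY : ∀ m → El (YIndex m) → Vec Bool (dim m)
    TY zero S = replicate r false
    TY (suc m) ((s1 , s2 , σ3) , y) = false ∷ false ∷ tOf σ3 ∷ TY m y
    SY zero S = S
    SY (suc m) ((s1 , s2 , σ3) , y) = s1 ∷ s2 ∷ sOf σ3 ∷ SY m y

    setOf : ∀ m → El (ZIndex m) → Vec Bool (dim m)
    setOf zero T = T
    setOf (suc m) ((t1 , t2 , t3) , z) = t1 ∷ t2 ∷ t3 ∷ setOf m z

    indexOf : ∀ m → Vec Bool (dim m) → El (ZIndex m)
    indexOf zero T = T
    indexOf (suc m) (t1 ∷ t2 ∷ t3 ∷ T) = ((t1 , t2 , t3) , indexOf m T)

    setOf-indexOf : ∀ m T → setOf m (indexOf m T) ≡ T
    setOf-indexOf zero T = P.refl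
    setOf-indexOf (suc m) (t1 ∷ t2 ∷ t3 ∷ T) = P.cong (λ q → t1 ∷ t2 ∷ t3 ∷ q) (setOf-indexOf m T)

    xIndex : ∀ m → El (ZIndex m) → Vec Bool (dim m) → El (XIndex m)
    xIndex zero T S = sts S T
    xIndex (suc m) ((t1 , t2 , t3) , z) (s1 ∷ s2 ∷ s3 ∷ S) = ((st s1 t1 , st s2 t2 , s3) , xIndex m z S)

    yIndex : ∀ m → El (ZIndex m) → Vec Bool (dim m) → El (YIndex m)
    yIndex zero T S = S
    yIndex (suc m) ((t1 , t2 , t3) , z) (s1 ∷ s2 ∷ s3 ∷ S) = ((s1 , s2 , st s3 t3) , yIndex m z S)

    SX-xIndex : ∀ m z S → SX m (xIndex m z S) ≡ S
    SX-xIndex zero T S = sOfs-sts S T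
    SX-xIndex (suc m) ((t1 , t2 , t3) , z) (s1 ∷ s2 ∷ s3 ∷ S) =
      P.cong₂ _∷_ (sOf-st s1 t1) (P.cong₂ _∷_ (sOf-st s2 t2) (P.cong (s3 ∷_) (SX-xIndex m z S)))

    SY-yIndex : ∀ m z S → SY m (yIndex m z S) ≡ S
    SY-yIndex zero T S = P.refl
    SY-yIndex (suc m) ((t1 , t2 , t3) , z) (s1 ∷ s2 ∷ s3 ∷ S) =
      P.cong (λ q → s1 ∷ s2 ∷ q) (P.cong₂ _∷_ (sOf-st s3 t3) (SY-yIndex m z S))

    merge-index : ∀ m z S → S ⊆ᵥ setOf m z → Merge (TX m (xIndex m z S)) (TY m (yIndex m z S)) (setOf m z)
    merge-index zero T S h = merge-allX S T h
    merge-index (suc m) ((t1 , t2 , t3) , z) (s1 ∷ s2 ∷ s3 ∷ S) (l1 ∷ᵥ (l2 ∷ᵥ (l3 ∷ᵥ h))) =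
      merge-X l1 (merge-X l2 (merge-Y l3 (merge-index m z S h)))

    Operands : ℕ → Code
    Operands m = (Terms ⊗ XIndex m) ⊕c (Terms ⊗ YIndex m)

    opCount : ℕ → ℕ
    opCount zero = card (vec bool r) *ℕ (2 ^ r *ℕ 2)
    opCount (suc m) = card (Operands m) *ℕ 1 +ℕ (card Terms *ℕ opCount m +ℕ card (ZIndex (suc m)) *ℕ 9)

module SubsetSums {c ℓ : Level} (R : CommutativeRing c ℓ) where

  open CommutativeRing R
  open import Algebra.Properties.AbelianGroup +-abelianGroup using (⁻¹-∙-comm)
  open import Algebra.Properties.CommutativeSemigroup +-commutativeSemigroup using (interchange)
  open import Data.Vec using (Vec; []; _∷_)
  open import Data.Bool using (Bool; true; false; f≤t; b≤b)
  open import Data.List using ([]; _∷_; map; _++_)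
  import Data.List.Properties as Listₚ
  import Relation.Binary.PropositionalEquality as P
  open import Relation.Binary.Reasoning.Setoid setoid
  open Semantics R using (sumList)
  open Splitting using (_⊆ᵥ_; []ᵥ; _∷ᵥ_)

  Σ≤ : Bool → (Bool → Carrier) → Carrier
  Σ≤ false h = h false
  Σ≤ true h = h false + h true

  Σ≤-cong : ∀ t {h h' : Bool → Carrier} → (∀ s → h s ≈ h' s) → Σ≤ t h ≈ Σ≤ t h'
  Σ≤-cong false e = e false
  Σ≤-cong true e = +-cong (e false) (e true)

  Σ≤-+ : ∀ t (h g : Bool → Carrier) → Σ≤ t (λ s → h s + g s) ≈ Σ≤ t h + Σ≤ t g
  Σ≤-+ false h g = refl
  Σ≤-+ true h g = interchange _ _ _ _

  Σ≤-neg : ∀ t (h : Bool → Carrier) → Σ≤ t (λ s → - h s) ≈ - Σ≤ t h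
  Σ≤-neg false h = refl
  Σ≤-neg true h = ⁻¹-∙-comm _ _

  Σ≤-swap : ∀ a b (h : Bool → Bool → Carrier) → Σ≤ a (λ x → Σ≤ b (h x)) ≈ Σ≤ b (λ y → Σ≤ a (λ x → h x y))
  Σ≤-swap false false h = refl
  Σ≤-swap false true h = refl
  Σ≤-swap true false h = refl
  Σ≤-swap true true h = interchange _ _ _ _

  Σ⊆ : ∀ {k} → Vec Bool k → (Vec Bool k → Carrier) → Carrier
  Σ⊆ [] F = F []
  Σ⊆ (t ∷ T) F = Σ≤ t (λ s → Σ⊆ T (λ S → F (s ∷ S)))

  Σ⊆-cong : ∀ {k} (T : Vec Bool k) {F G : Vec Bool k → Carrier} → (∀ S → S ⊆ᵥ T → F S ≈ G S) → Σ⊆ T F ≈ Σ⊆ T G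
  Σ⊆-cong [] e = e [] []ᵥ
  Σ⊆-cong (false ∷ T) e = Σ⊆-cong T (λ S h → e (false ∷ S) (b≤b ∷ᵥ h))
  Σ⊆-cong (true ∷ T) e =
    +-cong (Σ⊆-cong T (λ S h → e (false ∷ S) (f≤t ∷ᵥ h))) (Σ⊆-cong T (λ S h → e (true ∷ S) (b≤b ∷ᵥ h)))

  Σ⊆-+ : ∀ {k} (T : Vec Bool k) (F G : Vec Bool k → Carrier) → Σ⊆ T (λ S → F S + G S) ≈ Σ⊆ T F + Σ⊆ T G
  Σ⊆-+ [] F G = refl
  Σ⊆-+ (t ∷ T) F G = trans (Σ≤-cong t (λ s → Σ⊆-+ T (λ S → F (s ∷ S)) (λ S → G (s ∷ S)))) (Σ≤-+ t _ _)

  Σ⊆-neg : ∀ {k} (T : Vec Bool k) (F : Vec Bool k → Carrier) → Σ⊆ T (λ S → - F S) ≈ - Σ⊆ T F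
  Σ⊆-neg [] F = refl
  Σ⊆-neg (t ∷ T) F = trans (Σ≤-cong t (λ s → Σ⊆-neg T (λ S → F (s ∷ S)))) (Σ≤-neg t _)

  sumList-++ : ∀ xs ys → sumList (xs ++ ys) ≈ sumList xs + sumList ys
  sumList-++ [] ys = sym (+-identityˡ _)
  sumList-++ (x ∷ xs) ys = trans (+-congˡ (sumList-++ xs ys)) (sym (+-assoc _ _ _))

  Σ⊆-subsetsOf : ∀ {k} (T : Vec Bool k) (F : Vec Bool k → Carrier) → Σ⊆ T F ≈ sumList (map F (subsetsOf T))
  Σ⊆-subsetsOf [] F = sym (+-identityʳ _)
  Σ⊆-subsetsOf (false ∷ T) F = trans (Σ⊆-subsetsOf T _) (reflexive (P.cong sumList (Listₚ.map-∘ (subsetsOf T))))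
  Σ⊆-subsetsOf (true ∷ T) F = begin
    Σ⊆ T (λ S → F (false ∷ S)) + Σ⊆ T (λ S → F (true ∷ S))
      ≈⟨ +-cong (Σ⊆-subsetsOf T _) (Σ⊆-subsetsOf T _) ⟩
    sumList (map (λ S → F (false ∷ S)) L) + sumList (map (λ S → F (true ∷ S)) L)
      ≡⟨ P.cong₂ _+_ (P.cong sumList (Listₚ.map-∘ L)) (P.cong sumList (Listₚ.map-∘ L)) ⟩
    sumList (map F (map (false ∷_) L)) + sumList (map F (map (true ∷_) L))
      ≈⟨ sym (sumList-++ (map F (map (false ∷_) L)) (map F (map (true ∷_) L))) ⟩
    sumList (map F (map (false ∷_) L) ++ map F (map (true ∷_) L))
      ≡⟨ P.cong sumList (P.sym (Listₚ.map-++ F (map (false ∷_) L) _)) ⟩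
    sumList (map F (map (false ∷_) L ++ map (true ∷_) L)) ∎
    where L = subsetsOf T

  record IsBilinear {P Q : Set} (B : (P → Carrier) → (Q → Carrier) → Carrier) : Set (c ⊔ ℓ) where
    field
      +ˡ : ∀ X₁ X₂ Y → B (λ x → X₁ x + X₂ x) Y ≈ B X₁ Y + B X₂ Y
      +ʳ : ∀ X Y₁ Y₂ → B X (λ y → Y₁ y + Y₂ y) ≈ B X Y₁ + B X Y₂
      negˡ : ∀ X Y → B (λ x → - X x) Y ≈ - B X Y
      negʳ : ∀ X Y → B X (λ y → - Y y) ≈ - B X Y

  bilinear-≈ : ∀ {P Q : Set} {B B' : (P → Carrier) → (Q → Carrier) → Carrier} →
               (∀ X Y → B X Y ≈ B' X Y) → IsBilinear B' → IsBilinear B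
  bilinear-≈ {B = B} {B'} e bil = record
    { +ˡ = λ X₁ X₂ Y → trans (e _ Y) (trans (+ˡ X₁ X₂ Y) (sym (+-cong (e X₁ Y) (e X₂ Y))))
    ; +ʳ = λ X Y₁ Y₂ → trans (e X _) (trans (+ʳ X Y₁ Y₂) (sym (+-cong (e X Y₁) (e X Y₂))))
    ; negˡ = λ X Y → trans (e _ Y) (trans (negˡ X Y) (-‿cong (sym (e X Y))))
    ; negʳ = λ X Y → trans (e X _) (trans (negʳ X Y) (-‿cong (sym (e X Y))))
    }
    where open IsBilinear bil

  pairing-bilinear : ∀ {k} {P Q : Set} (T : Vec Bool k) (a : Vec Bool k → P) (b : Vec Bool k → Q) →
                     IsBilinear (λ X Y → Σ⊆ T (λ S → X (a S) * Y (b S)))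
  pairing-bilinear T a b = record
    { +ˡ = λ X₁ X₂ Y → trans (Σ⊆-cong T (λ S _ → distribʳ _ _ _)) (Σ⊆-+ T _ _)
    ; +ʳ = λ X Y₁ Y₂ → trans (Σ⊆-cong T (λ S _ → distribˡ _ _ _)) (Σ⊆-+ T _ _)
    ; negˡ = λ X Y → trans (Σ⊆-cong T (λ S _ → sym (-‿distribˡ-* _ _))) (Σ⊆-neg T _)
    ; negʳ = λ X Y → trans (Σ⊆-cong T (λ S _ → sym (-‿distribʳ-* _ _))) (Σ⊆-neg T _)
    }
    where open import Algebra.Properties.Ring ring using (-‿distribˡ-*; -‿distribʳ-*)

-- Its definition follows the recursion, summing block by block; bilinearity
-- comes from the closed form.
module BlockForm {c ℓ : Level} (R : CommutativeRing c ℓ) (r : ℕ) where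

  open CommutativeRing R
  open import Data.Nat using (zero; suc)
  open import Data.Product using (_,_)
  open SubsetSums R
  open FiniteIndex
  open Splitting
  open Levels r

  Bil : ∀ m → (El (XIndex m) → Carrier) → (El (YIndex m) → Carrier) → El (ZIndex m) → Carrier
  Bil zero X Y T = Σ⊆ T (λ S → X (sts S T) * Y S)
  Bil (suc m) X Y ((t1 , t2 , t3) , z) =
    Σ≤ t1 λ s1 → Σ≤ t3 λ s3 → Σ≤ t2 λ s2 →
      Bil m (λ x → X ((st s1 t1 , st s2 t2 , s3) , x)) (λ y → Y ((s1 , s2 , st s3 t3) , y)) z

  Bil-closed : ∀ m X Y z → Bil m X Y z ≈ Σ⊆ (setOf m z) (λ S → X (xIndex m z S) * Y (yIndex m z S))
  Bil-closed zero X Y T = refl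
  Bil-closed (suc m) X Y ((t1 , t2 , t3) , z) =
    Σ≤-cong t1 λ s1 → trans (Σ≤-cong t3 λ s3 → Σ≤-cong t2 λ s2 → Bil-closed m _ _ z) (Σ≤-swap t3 t2 _)

  Bil-bilinear : ∀ m z → IsBilinear (λ X Y → Bil m X Y z)
  Bil-bilinear m z =
    bilinear-≈ (λ X Y → Bil-closed m X Y z) (pairing-bilinear (setOf m z) (xIndex m z) (yIndex m z))

module Strassen {c ℓ : Level} (R : CommutativeRing c ℓ) where

  open CommutativeRing R
  open import Data.Fin using (Fin; zero; suc)
  open import Data.Bool using (Bool; true; false)
  open import Algebra.Properties.AbelianGroup +-abelianGroup using (⁻¹-∙-comm)
  open import Algebra.Solver.CommutativeMonoid +-commutativeMonoid using (solve; _⊜_; _⊕_)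
  open import Relation.Binary.Reasoning.Setoid setoid
  open SubsetSums R using (IsBilinear; Σ≤)

  pattern m₁ = zero
  pattern m₂ = suc zero
  pattern m₃ = suc (suc zero)
  pattern m₄ = suc (suc (suc zero))
  pattern m₅ = suc (suc (suc (suc zero)))
  pattern m₆ = suc (suc (suc (suc (suc zero))))
  pattern m₇ = suc (suc (suc (suc (suc (suc zero)))))

  drop0 : ∀ x {y} → y ≈ 0# → x + y ≈ x
  drop0 x e = trans (+-congˡ e) (+-identityʳ x)

  pair0 : ∀ a {y} → y ≈ 0# → (a + - a) + y ≈ 0#
  pair0 a e = trans (+-cong (-‿inverseʳ a) e) (+-identityˡ 0#)

  module _ {P Q : Set} {B : (P → Carrier) → (Q → Carrier) → Carrier} (bil : IsBilinear B)
           (M : Bool → Bool → P → Carrier) (N : Bool → Bool → Q → Carrier) where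
    open IsBilinear bil

    B-−ˡ : ∀ X₁ X₂ Y → B (λ x → X₁ x - X₂ x) Y ≈ B X₁ Y + - B X₂ Y
    B-−ˡ X₁ X₂ Y = trans (+ˡ X₁ (λ x → - X₂ x) Y) (+-congˡ (negˡ X₂ Y))

    B-−ʳ : ∀ X Y₁ Y₂ → B X (λ y → Y₁ y - Y₂ y) ≈ B X Y₁ + - B X Y₂
    B-−ʳ X Y₁ Y₂ = trans (+ʳ X Y₁ (λ y → - Y₂ y)) (+-congˡ (negʳ X Y₂))

    B-++ : ∀ X₁ X₂ Y₁ Y₂ → B (λ x → X₁ x + X₂ x) (λ y → Y₁ y + Y₂ y) ≈ (B X₁ Y₁ + B X₁ Y₂) + (B X₂ Y₁ + B X₂ Y₂)
    B-++ X₁ X₂ Y₁ Y₂ = trans (+ˡ X₁ X₂ _) (+-cong (+ʳ X₁ Y₁ Y₂) (+ʳ X₂ Y₁ Y₂))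

    B-−+ : ∀ X₁ X₂ Y₁ Y₂ → B (λ x → X₁ x - X₂ x) (λ y → Y₁ y + Y₂ y) ≈ (B X₁ Y₁ + B X₁ Y₂) + (- B X₂ Y₁ + - B X₂ Y₂)
    B-−+ X₁ X₂ Y₁ Y₂ =
      trans (B-−ˡ X₁ X₂ _) (+-cong (+ʳ X₁ Y₁ Y₂) (trans (-‿cong (+ʳ X₂ Y₁ Y₂)) (sym (⁻¹-∙-comm _ _))))

    neg-+ˡ : ∀ X₁ X₂ Y → - B (λ x → X₁ x + X₂ x) Y ≈ - B X₁ Y + - B X₂ Y
    neg-+ˡ X₁ X₂ Y = trans (-‿cong (+ˡ X₁ X₂ Y)) (sym (⁻¹-∙-comm _ _))

    b : Bool → Bool → Bool → Bool → Carrier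
    b i j j' k = B (M i j) (N j' k)

    product : Fin 7 → Carrier
    product m₁ = B (λ x → M false false x + M true true x) (λ y → N false false y + N true true y)
    product m₂ = B (λ x → M true false x + M true true x) (N false false)
    product m₃ = B (M false false) (λ y → N false true y - N true true y)
    product m₄ = B (M true true) (λ y → N true false y - N false false y)
    product m₅ = B (λ x → M false false x + M false true x) (N true true)
    product m₆ = B (λ x → M true false x - M false false x) (λ y → N false false y + N false true y)
    product m₇ = B (λ x → M false true x - M true true x) (λ y → N true false y + N true true y)

    entry : Bool → Bool → Carrier
    entry false false = product m₁ + product m₄ - product m₅ + product m₇
    entry false true = product m₃ + product m₅
    entry true false = product m₂ + product m₄
    entry true true = product m₁ - product m₂ + product m₃ + product m₆

    strassen : ∀ i k → entry i k ≈ Σ≤ true (λ j → b i j j k)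
    strassen false false = begin
      product m₁ + product m₄ - product m₅ + product m₇
        ≈⟨ +-cong (+-cong (+-cong (B-++ _ _ _ _) (B-−ʳ _ _ _)) (neg-+ˡ _ _ _)) (B-−+ _ _ _ _) ⟩
      (((a₁ + a₂) + (a₃ + a₄)) + (a₅ + - a₃)) + (- a₂ + - a₆) + ((a₇ + a₆) + (- a₅ + - a₄))
        ≈⟨ solve 12 (λ a₁ a₂ a₃ a₄ a₅ a₆ a₇ n₂ n₃ n₄ n₅ n₆ →
             ((((a₁ ⊕ a₂) ⊕ (a₃ ⊕ a₄)) ⊕ (a₅ ⊕ n₃)) ⊕ (n₂ ⊕ n₆)) ⊕ ((a₇ ⊕ a₆) ⊕ (n₅ ⊕ n₄))
             ⊜ (a₁ ⊕ a₇) ⊕ ((a₂ ⊕ n₂) ⊕ ((a₃ ⊕ n₃) ⊕ ((a₄ ⊕ n₄) ⊕ ((a₅ ⊕ n₅) ⊕ (a₆ ⊕ n₆))))))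
             refl a₁ a₂ a₃ a₄ a₅ a₆ a₇ (- a₂) (- a₃) (- a₄) (- a₅) (- a₆) ⟩
      (a₁ + a₇) + ((a₂ - a₂) + ((a₃ - a₃) + ((a₄ - a₄) + ((a₅ - a₅) + (a₆ - a₆)))))
        ≈⟨ drop0 _ (pair0 a₂ (pair0 a₃ (pair0 a₄ (pair0 a₅ (-‿inverseʳ a₆))))) ⟩
      a₁ + a₇ ∎
      where
      a₁ = b false false false false ; a₂ = b false false true true ; a₃ = b true true false false
      a₄ = b true true true true ; a₅ = b true true true false ; a₆ = b false true true true
      a₇ = b false true true false
    strassen false true = begin
      product m₃ + product m₅ ≈⟨ +-cong (B-−ʳ _ _ _) (+ˡ _ _ _) ⟩
      (a₁ + - a₂) + (a₂ + a₃)
        ≈⟨ solve 4 (λ a₁ a₂ a₃ n₂ → (a₁ ⊕ n₂) ⊕ (a₂ ⊕ a₃) ⊜ (a₁ ⊕ a₃) ⊕ (a₂ ⊕ n₂)) refl a₁ a₂ a₃ (- a₂) ⟩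
      (a₁ + a₃) + (a₂ - a₂) ≈⟨ drop0 _ (-‿inverseʳ a₂) ⟩
      a₁ + a₃ ∎
      where
      a₁ = b false false false true ; a₂ = b false false true true ; a₃ = b false true true true
    strassen true false = begin
      product m₂ + product m₄ ≈⟨ +-cong (+ˡ _ _ _) (B-−ʳ _ _ _) ⟩
      (a₁ + a₂) + (a₃ + - a₂)
        ≈⟨ solve 4 (λ a₁ a₂ a₃ n₂ → (a₁ ⊕ a₂) ⊕ (a₃ ⊕ n₂) ⊜ (a₁ ⊕ a₃) ⊕ (a₂ ⊕ n₂)) refl a₁ a₂ a₃ (- a₂) ⟩
      (a₁ + a₃) + (a₂ - a₂) ≈⟨ drop0 _ (-‿inverseʳ a₂) ⟩
      a₁ + a₃ ∎
      where
      a₁ = b true false false false ; a₂ = b true true false false ; a₃ = b true true true false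
    strassen true true = begin
      product m₁ - product m₂ + product m₃ + product m₆
        ≈⟨ +-cong (+-cong (+-cong (B-++ _ _ _ _) (neg-+ˡ _ _ _)) (B-−ʳ _ _ _)) (B-−+ _ _ _ _) ⟩
      (((a₁ + a₂) + (a₃ + a₄)) + (- a₅ + - a₃)) + (a₆ + - a₂) + ((a₅ + a₇) + (- a₁ + - a₆))
        ≈⟨ solve 12 (λ a₁ a₂ a₃ a₄ a₅ a₆ a₇ n₁ n₂ n₃ n₅ n₆ →
             ((((a₁ ⊕ a₂) ⊕ (a₃ ⊕ a₄)) ⊕ (n₅ ⊕ n₃)) ⊕ (a₆ ⊕ n₂)) ⊕ ((a₅ ⊕ a₇) ⊕ (n₁ ⊕ n₆))
             ⊜ (a₇ ⊕ a₄) ⊕ ((a₁ ⊕ n₁) ⊕ ((a₂ ⊕ n₂) ⊕ ((a₃ ⊕ n₃) ⊕ ((a₅ ⊕ n₅) ⊕ (a₆ ⊕ n₆))))))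
             refl a₁ a₂ a₃ a₄ a₅ a₆ a₇ (- a₁) (- a₂) (- a₃) (- a₅) (- a₆) ⟩
      (a₇ + a₄) + ((a₁ - a₁) + ((a₂ - a₂) + ((a₃ - a₃) + ((a₅ - a₅) + (a₆ - a₆)))))
        ≈⟨ drop0 _ (pair0 a₁ (pair0 a₂ (pair0 a₃ (pair0 a₅ (-‿inverseʳ a₆))))) ⟩
      a₇ + a₄ ∎
      where
      a₁ = b false false false false ; a₂ = b false false true true ; a₃ = b true true false false
      a₄ = b true true true true ; a₅ = b true false false false ; a₆ = b false false false true
      a₇ = b true false false true

-- One level: form the two operands of
-- each of the 26 terms (cost ≤ 1 each), evaluate the 26 terms by 26 circuits of
-- level m, and combine them into the 8 outputs per lower output index (cost ≤ 9).
module Recursion {c ℓ : Level} (R : CommutativeRing c ℓ) (N : ℕ) (r : ℕ) where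

  open CommutativeRing R hiding (zero)
  open import Data.Nat using (zero; suc; _≤_; z≤n; s≤s; _^_) renaming (_+_ to _+ℕ_; _*_ to _*ℕ_)
  import Data.Nat.Properties as ℕₚ
  open import Data.Vec using (Vec; []; _∷_)
  open import Data.Bool using (Bool; true; false)
  open import Data.Product using (_×_; _,_)
  open import Data.Sum using (_⊎_; inj₁; inj₂)
  open import Function using (_∘_)
  open import Relation.Binary.PropositionalEquality as P using (_≡_)
  open FiniteIndex
  open Circuits R N
  open SubsetSums R
  open Splitting
  open Levels r
  open BlockForm R r
  open Strassen R using (m₁; m₂; m₃; m₄; m₅; m₆; m₇; strassen)

  module _ {I : Set} where
    Σ≤E : Bool → (Bool → Expr I) → Expr I
    Σ≤E false h = h false
    Σ≤E true h = h false ⊕ h true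

    Σ≤E-sem : ∀ t (h : Bool → Expr I) f v → ⟦ Σ≤E t h ⟧ f v ≡ Σ≤ t (λ s → ⟦ h s ⟧ f v)
    Σ≤E-sem false h f v = P.refl
    Σ≤E-sem true h f v = P.refl

    Σ⊆E : ∀ {k} → Vec Bool k → (Vec Bool k → Expr I) → Expr I
    Σ⊆E [] F = F []
    Σ⊆E (t ∷ T) F = Σ≤E t (λ s → Σ⊆E T (λ S → F (s ∷ S)))

    Σ⊆E-sem : ∀ {k} (T : Vec Bool k) (F : Vec Bool k → Expr I) f v → ⟦ Σ⊆E T F ⟧ f v ≈ Σ⊆ T (λ S → ⟦ F S ⟧ f v)
    Σ⊆E-sem [] F f v = refl
    Σ⊆E-sem (t ∷ T) F f v = trans (reflexive (Σ≤E-sem t _ f v)) (Σ≤-cong t (λ s → Σ⊆E-sem T _ f v))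

    -- at most 2^k summands of size ≤ s, and fewer additions than summands
    Σ⊆E-size : ∀ {k} (T : Vec Bool k) (F : Vec Bool k → Expr I) s → (∀ S → size (F S) ≤ s) →
               suc (size (Σ⊆E T F)) ≤ 2 ^ k *ℕ suc s
    Σ⊆E-size [] F s bd = ℕₚ.≤-trans (s≤s (bd [])) (ℕₚ.≤-reflexive (P.sym (ℕₚ.+-identityʳ (suc s))))
    Σ⊆E-size {suc k} (false ∷ T) F s bd =
      ℕₚ.≤-trans (Σ⊆E-size T _ s (λ S → bd _)) (ℕₚ.*-monoˡ-≤ (suc s) (ℕₚ.m≤m+n (2 ^ k) _))
    Σ⊆E-size {suc k} (true ∷ T) F s bd =
      ℕₚ.≤-trans (s≤s (ℕₚ.≤-reflexive (P.sym (ℕₚ.+-suc (size (Σ⊆E T (λ S → F (false ∷ S)))) _))))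
        (ℕₚ.≤-trans (ℕₚ.+-mono-≤ (Σ⊆E-size T _ s (λ S → bd _)) (Σ⊆E-size T _ s (λ S → bd _)))
          (ℕₚ.≤-reflexive (P.trans (P.sym (ℕₚ.*-distribʳ-+ (suc s) (2 ^ k) (2 ^ k)))
             (P.cong (_*ℕ suc s) (P.cong (2 ^ k +ℕ_) (P.sym (ℕₚ.+-identityʳ (2 ^ k))))))))

  data Operand (A : Set) : Set where
    entry : A → Operand A
    combine : Op → A → A → Operand A

  operandExpr : ∀ {A I : Set} → Operand A → (A → I) → Expr I
  operandExpr (entry a) g = leaf (g a)
  operandExpr (combine o a a') g = bin o (leaf (g a)) (leaf (g a'))

  operandExpr-size : ∀ {A I : Set} (u : Operand A) (g : A → I) → size (operandExpr u g) ≤ 1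
  operandExpr-size (entry a) g = z≤n
  operandExpr-size (combine o a a') g = s≤s z≤n

  mEntry : Bool → Bool → El XBlock
  mEntry i j = (st false i , st j true , false)

  nEntry : Bool → Bool → El YBlock
  nEntry j k = (false , j , st false k)

  leftOperand : El Terms → Operand (El XBlock)
  leftOperand (term00 t1 t3) = entry (st false t1 , s00 , false)
  leftOperand (term10 t3 σ) = entry (s11 , σ , false)
  leftOperand (term01 t1 σ) = entry (st false t1 , σ , true)
  leftOperand (term11 σ) = entry (s11 , σ , true)
  leftOperand (termS m₁) = combine plus (mEntry false false) (mEntry true true)
  leftOperand (termS m₂) = combine plus (mEntry true false) (mEntry true true)
  leftOperand (termS m₃) = entry (mEntry false false)
  leftOperand (termS m₄) = entry (mEntry true true)
  leftOperand (termS m₅) = combine plus (mEntry false false) (mEntry false true)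
  leftOperand (termS m₆) = combine minus (mEntry true false) (mEntry false false)
  leftOperand (termS m₇) = combine minus (mEntry false true) (mEntry true true)

  rightOperand : El Terms → Operand (El YBlock)
  rightOperand (term00 t1 t3) = entry (false , false , st false t3)
  rightOperand (term10 t3 σ) = entry (true , sOf σ , st false t3)
  rightOperand (term01 t1 σ) = entry (false , sOf σ , s11)
  rightOperand (term11 σ) = entry (true , sOf σ , s11)
  rightOperand (termS m₁) = combine plus (nEntry false false) (nEntry true true)
  rightOperand (termS m₂) = entry (nEntry false false)
  rightOperand (termS m₃) = combine minus (nEntry false true) (nEntry true true)
  rightOperand (termS m₄) = combine minus (nEntry true false) (nEntry false false)
  rightOperand (termS m₅) = entry (nEntry true true)
  rightOperand (termS m₆) = combine plus (nEntry false false) (nEntry false true)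
  rightOperand (termS m₇) = combine plus (nEntry true false) (nEntry true true)

  In : ℕ → Set
  In m = El (XIndex m) ⊎ El (YIndex m)

  operandsExpr : ∀ m → El (Operands m) → Expr (In (suc m))
  operandsExpr m (inj₁ (ρ , x)) = operandExpr (leftOperand ρ) (λ xb → inj₁ (xb , x))
  operandsExpr m (inj₂ (ρ , y)) = operandExpr (rightOperand ρ) (λ yb → inj₂ (yb , y))

  operandsExpr-size : ∀ m o → size (operandsExpr m o) ≤ 1
  operandsExpr-size m (inj₁ (ρ , x)) = operandExpr-size (leftOperand ρ) _
  operandsExpr-size m (inj₂ (ρ , y)) = operandExpr-size (rightOperand ρ) _

  operandsOf : ∀ {m} → El Terms → In m → El (Operands m)
  operandsOf ρ (inj₁ x) = inj₁ (ρ , x)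
  operandsOf ρ (inj₂ y) = inj₂ (ρ , y)

  module _ {I : Set} (L : El Terms → Expr I) where
    strassenEntry : Bool → Bool → Expr I
    strassenEntry false false = L (termS m₁) ⊕ L (termS m₄) ⊖ L (termS m₅) ⊕ L (termS m₇)
    strassenEntry false true = L (termS m₃) ⊕ L (termS m₅)
    strassenEntry true false = L (termS m₂) ⊕ L (termS m₄)
    strassenEntry true true = L (termS m₁) ⊖ L (termS m₂) ⊕ L (termS m₃) ⊕ L (termS m₆)

    part : Bool → Bool → Bool → Bool → Bool → Expr I
    part t1 true t3 false false = strassenEntry t1 t3
    part t1 false t3 false false = L (term00 t1 t3)
    part t1 t2 t3 true false = Σ≤E t2 (λ s2 → L (term10 t3 (st s2 t2)))
    part t1 t2 t3 false true = Σ≤E t2 (λ s2 → L (term01 t1 (st s2 t2)))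
    part t1 t2 t3 true true = Σ≤E t2 (λ s2 → L (term11 (st s2 t2)))

    outputExpr : El ZBlock → Expr I
    outputExpr (t1 , t2 , t3) = Σ≤E t1 (λ s1 → Σ≤E t3 (λ s3 → part t1 t2 t3 s1 s3))

  TermValues : ℕ → Set
  TermValues m = El Terms × El (ZIndex m)

  outputsExpr : ∀ m → El (ZIndex (suc m)) → Expr (TermValues m)
  outputsExpr m (t , z) = outputExpr (λ ρ → leaf (ρ , z)) t

  outputsExpr-size : ∀ m o → size (outputsExpr m o) ≤ 9
  outputsExpr-size m ((false , false , false) , z) = ℕₚ.≤ᵇ⇒≤ _ _ _
  outputsExpr-size m ((false , false , true) , z) = ℕₚ.≤ᵇ⇒≤ _ _ _
  outputsExpr-size m ((false , true , false) , z) = ℕₚ.≤ᵇ⇒≤ _ _ _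
  outputsExpr-size m ((false , true , true) , z) = ℕₚ.≤ᵇ⇒≤ _ _ _
  outputsExpr-size m ((true , false , false) , z) = ℕₚ.≤ᵇ⇒≤ _ _ _
  outputsExpr-size m ((true , false , true) , z) = ℕₚ.≤ᵇ⇒≤ _ _ _
  outputsExpr-size m ((true , true , false) , z) = ℕₚ.≤ᵇ⇒≤ _ _ _
  outputsExpr-size m ((true , true , true) , z) = ℕₚ.≤ᵇ⇒≤ _ _ _

  module OneLevel (m : ℕ) (f : Input) (v : In (suc m) → Carrier) where
    termValue : TermValues m → Carrier
    termValue (ρ , z) = Bil m (λ x → ⟦ operandExpr (leftOperand ρ) (λ xb → inj₁ (xb , x)) ⟧ f v)
                              (λ y → ⟦ operandExpr (rightOperand ρ) (λ yb → inj₂ (yb , y)) ⟧ f v) z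

    M : Bool → Bool → El (XIndex m) → Carrier
    M i j x = v (inj₁ (mEntry i j , x))

    N′ : Bool → Bool → El (YIndex m) → Carrier
    N′ j k y = v (inj₂ (nEntry j k , y))

    summand : Bool → Bool → Bool → Bool → Bool → Bool → El (ZIndex m) → Carrier
    summand t1 t2 t3 s1 s3 s2 z =
      Bil m (λ x → v (inj₁ ((st s1 t1 , st s2 t2 , s3) , x))) (λ y → v (inj₂ ((s1 , s2 , st s3 t3) , y))) z

    part-correct : ∀ t1 t2 t3 s1 s3 z →
                   ⟦ part (λ ρ → leaf (ρ , z)) t1 t2 t3 s1 s3 ⟧ f termValue ≈ Σ≤ t2 (λ s2 → summand t1 t2 t3 s1 s3 s2 z)
    part-correct false true false false false z = strassen (Bil-bilinear m z) M N′ false false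
    part-correct false true true false false z = strassen (Bil-bilinear m z) M N′ false true
    part-correct true true false false false z = strassen (Bil-bilinear m z) M N′ true false
    part-correct true true true false false z = strassen (Bil-bilinear m z) M N′ true true
    part-correct t1 false t3 false false z = refl
    part-correct t1 false t3 true false z = refl
    part-correct t1 true t3 true false z = refl
    part-correct t1 false t3 false true z = refl
    part-correct t1 true t3 false true z = refl
    part-correct t1 false t3 true true z = refl
    part-correct t1 true t3 true true z = refl

    output-correct : ∀ t z → ⟦ outputsExpr m (t , z) ⟧ f termValue ≈ Bil (suc m) (v ∘ inj₁) (v ∘ inj₂) (t , z)
    output-correct (t1 , t2 , t3) z =
      trans (reflexive (Σ≤E-sem t1 _ f termValue)) (Σ≤-cong t1 λ s1 →
        trans (reflexive (Σ≤E-sem t3 _ f termValue)) (Σ≤-cong t3 λ s3 → part-correct t1 t2 t3 s1 s3 z))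

  baseExpr : El (ZIndex zero) → Expr (In zero)
  baseExpr T = Σ⊆E T (λ S → leaf (inj₁ (sts S T)) ⊛ leaf (inj₂ S))

  baseExpr-size : ∀ T → size (baseExpr T) ≤ 2 ^ r *ℕ 2
  baseExpr-size T = ℕₚ.≤-trans (ℕₚ.n≤1+n _) (Σ⊆E-size T _ 1 (λ S → ℕₚ.≤-refl))

  BilSpec : ∀ m → Input → (In m → Carrier) → El (ZIndex m) → Carrier
  BilSpec m f v = Bil m (v ∘ inj₁) (v ∘ inj₂)

  bilCircuit : ∀ m → Circuit (In m) (El (ZIndex m)) (opCount m)
  bilCore : ∀ m → Circuit (In m) (El (ZIndex m)) (opCount m)
  bilCore-spec : ∀ m f v z → spec (bilCore m) f v z ≈ BilSpec m f v z

  bilCircuit m = respec (bilCore m) (BilSpec m) (bilCore-spec m)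

  bilCore zero = layer (vec bool r) baseExpr (2 ^ r *ℕ 2) baseExpr-size
  bilCore (suc m) =
    seq (layer (Operands m) (operandsExpr m) 1 (operandsExpr-size m))
        (seq (family Terms (λ ρ → reindexIn (operandsOf ρ) (bilCircuit m)))
             (layer (ZIndex (suc m)) (outputsExpr m) 9 (outputsExpr-size m)))

  bilCore-spec zero f v T = Σ⊆E-sem T _ f v
  bilCore-spec (suc m) f v (t , z) = OneLevel.output-correct m f v t z

-- The operation count is O(26^(n/3)) = O(2.9625^n), comfortably below 2.985^n.
module Cost where

  open import Data.Bool using (T)
  open import Data.Nat using (ℕ; zero; suc; _≤_; _≤ᵇ_; z≤n; s≤s; _^_; _+_; _*_)
  open import Data.Nat.Properties
  open import Data.Nat.Tactic.RingSolver using (solve-∀)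
  open import Relation.Binary.PropositionalEquality as P using (_≡_)
  open FiniteIndex
  open Splitting

  dec≤ : ∀ a b → {_ : T (a ≤ᵇ b)} → a ≤ b
  dec≤ a b {h} = ≤ᵇ⇒≤ a b h

  -- (a b)^m = a^m b^m  (the library states this only for its own semiring exponentiation)
  *-^ : ∀ a b m → (a * b) ^ m ≡ a ^ m * b ^ m
  *-^ a b zero = P.refl
  *-^ a b (suc m) = P.trans (P.cong ((a * b) *_) (*-^ a b m)) (lem a b (a ^ m) (b ^ m))
    where
    lem : ∀ a b x y → a * b * (x * y) ≡ a * x * (b * y)
    lem = solve-∀

  m*18^m≤26^m : ∀ m → m * 18 ^ m ≤ 26 ^ m
  m*18^m≤26^m zero = z≤n
  m*18^m≤26^m (suc zero) = dec≤ _ _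
  m*18^m≤26^m (suc (suc zero)) = dec≤ _ _
  m*18^m≤26^m (suc (suc (suc k))) = from3 k
    where
    from3 : ∀ k → (3 + k) * 18 ^ (3 + k) ≤ 26 ^ (3 + k)
    from3 zero = dec≤ _ _
    from3 (suc k) = begin
      (4 + k) * (18 * x) ≤⟨ m≤m+n _ (6 * x + 8 * k * x) ⟩
      (4 + k) * (18 * x) + (6 * x + 8 * k * x) ≡⟨ lem k x ⟩
      26 * ((3 + k) * x) ≤⟨ *-monoʳ-≤ 26 (from3 k) ⟩
      26 * 26 ^ (3 + k) ∎
      where
      open ≤-Reasoning
      x = 18 ^ (3 + k)
      lem : ∀ k x → (4 + k) * (18 * x) + (6 * x + 8 * k * x) ≡ 26 * ((3 + k) * x)
      lem = solve-∀

  -- since 26 · 1000³ ≤ 2985³:  26^m · 1000^(3m+r) ≤ 10^6 · 2985^(3m+r)  for r ≤ 2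
  26^m-to-2985 : ∀ m r → r ≤ 2 → 26 ^ m * 1000 ^ (m * 3 + r) ≤ 1000000 * 2985 ^ (m * 3 + r)
  26^m-to-2985 m r hr = begin
    26 ^ m * 1000 ^ (m * 3 + r) ≡⟨ P.cong (26 ^ m *_) (^-distribˡ-+-* 1000 (m * 3) r) ⟩
    26 ^ m * (1000 ^ (m * 3) * 1000 ^ r) ≡⟨ P.cong (λ q → 26 ^ m * (q * 1000 ^ r)) (^-cube 1000) ⟩
    26 ^ m * ((1000 ^ 3) ^ m * 1000 ^ r) ≡⟨ P.sym (*-assoc (26 ^ m) _ _) ⟩
    (26 ^ m * (1000 ^ 3) ^ m) * 1000 ^ r ≡⟨ P.cong (_* 1000 ^ r) (P.sym (*-^ 26 (1000 ^ 3) m)) ⟩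
    (26 * 1000 ^ 3) ^ m * 1000 ^ r ≤⟨ *-mono-≤ (^-monoˡ-≤ m (dec≤ (26 * 1000 ^ 3) (2985 ^ 3))) (^-monoʳ-≤ 1000 hr) ⟩
    (2985 ^ 3) ^ m * 1000 ^ 2 ≡⟨ *-comm ((2985 ^ 3) ^ m) (1000 ^ 2) ⟩
    1000000 * (2985 ^ 3) ^ m ≡⟨ P.cong (1000000 *_) (P.sym (^-cube 2985)) ⟩
    1000000 * 2985 ^ (m * 3) ≤⟨ *-monoʳ-≤ 1000000 (^-monoʳ-≤ 2985 (m≤m+n (m * 3) r)) ⟩
    1000000 * 2985 ^ (m * 3 + r) ∎
    where
    open ≤-Reasoning
    ^-cube : ∀ a → a ^ (m * 3) ≡ (a ^ 3) ^ m
    ^-cube a = P.trans (P.cong (a ^_) (*-comm m 3)) (P.sym (^-*-assoc a 3 m))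

  -- one level of the recursion preserves the invariant  k + 79 · 18^m ≤ 111 · 26^m
  level-step : ∀ cx cy cz k t u → cx ≤ t * 9 → cy ≤ t * 4 → cz ≤ t * 4 → k + 79 * t ≤ 111 * u →
               (26 * cx + 26 * cy) * 1 + (26 * k + 8 * cz * 9) + 79 * (18 * t) ≤ 111 * (26 * u)
  level-step cx cy cz k t u hx hy hz hk = begin
    (26 * cx + 26 * cy) * 1 + (26 * k + 8 * cz * 9) + 79 * (18 * t)
      ≤⟨ +-monoˡ-≤ (79 * (18 * t)) (+-mono-≤ (*-monoˡ-≤ 1 (+-mono-≤ (*-monoʳ-≤ 26 hx) (*-monoʳ-≤ 26 hy)))
                                              (+-monoʳ-≤ (26 * k) (*-monoˡ-≤ 9 (*-monoʳ-≤ 8 hz)))) ⟩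
    (26 * (t * 9) + 26 * (t * 4)) * 1 + (26 * k + 8 * (t * 4) * 9) + 79 * (18 * t)
      ≤⟨ m≤m+n _ (6 * t) ⟩
    (26 * (t * 9) + 26 * (t * 4)) * 1 + (26 * k + 8 * (t * 4) * 9) + 79 * (18 * t) + 6 * t
      ≡⟨ lem k t ⟩
    26 * (k + 79 * t) ≤⟨ *-monoʳ-≤ 26 hk ⟩
    26 * (111 * u) ≡⟨ lem2 u ⟩
    111 * (26 * u) ∎
    where
    open ≤-Reasoning
    lem : ∀ k t → (26 * (t * 9) + 26 * (t * 4)) * 1 + (26 * k + 8 * (t * 4) * 9) + 79 * (18 * t) + 6 * t ≡ 26 * (k + 79 * t)
    lem = solve-∀
    lem2 : ∀ u → 26 * (111 * u) ≡ 111 * (26 * u)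
    lem2 = solve-∀

  -- the top level adds the tables of the X and Y values, each entry a product of ≤ 3m + r factors
  top-level : ∀ cx cy k m r t u → cx ≤ t * 9 → cy ≤ t * 4 → r ≤ 2 → m * t ≤ u → t ≤ u → k ≤ 111 * u →
              (cx + cy) * (m * 3 + r) + k ≤ 176 * u
  top-level cx cy k m r t u hx hy hr hm ht hk = begin
    (cx + cy) * (m * 3 + r) + k ≤⟨ +-mono-≤ (*-mono-≤ (+-mono-≤ hx hy) (+-monoʳ-≤ (m * 3) hr)) hk ⟩
    (t * 9 + t * 4) * (m * 3 + 2) + 111 * u ≡⟨ P.cong (_+ 111 * u) (lem m t) ⟩
    39 * (m * t) + 26 * t + 111 * u ≤⟨ +-monoˡ-≤ (111 * u) (+-mono-≤ (*-monoʳ-≤ 39 hm) (*-monoʳ-≤ 26 ht)) ⟩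
    39 * u + 26 * u + 111 * u ≡⟨ lem2 u ⟩
    176 * u ∎
    where
    open ≤-Reasoning
    lem : ∀ m t → (t * 9 + t * 4) * (m * 3 + 2) ≡ 39 * (m * t) + 26 * t
    lem = solve-∀
    lem2 : ∀ u → 39 * u + 26 * u + 111 * u ≡ 176 * u
    lem2 = solve-∀

  upTo2 : ∀ {P : ℕ → Set} → P 0 → P 1 → P 2 → ∀ r → r ≤ 2 → P r
  upTo2 p0 p1 p2 zero _ = p0
  upTo2 p0 p1 p2 (suc zero) _ = p1
  upTo2 p0 p1 p2 (suc (suc zero)) _ = p2
  upTo2 p0 p1 p2 (suc (suc (suc r))) (s≤s (s≤s ()))

  module Counts (r : ℕ) (hr : r ≤ 2) where
    open Levels r

    card-X : ∀ m → card (XIndex m) ≤ 18 ^ m * 9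
    card-X zero = ≤-trans (upTo2 {λ r → card (vec st3 r) ≤ 9} (dec≤ _ _) (dec≤ _ _) (dec≤ _ _) r hr)
                    (≤-reflexive (P.sym (*-identityˡ 9)))
    card-X (suc m) = ≤-trans (*-monoʳ-≤ 18 (card-X m)) (≤-reflexive (P.sym (*-assoc 18 (18 ^ m) 9)))

    card-vec-bool : card (vec bool r) ≤ 1 * 4
    card-vec-bool = upTo2 {λ r → card (vec bool r) ≤ 4} (dec≤ _ _) (dec≤ _ _) (dec≤ _ _) r hr

    card-≤18 : ∀ (b : Code) (F : ℕ → Code) → card b ≤ 18 → card (F zero) ≤ 1 * 4 →
               (∀ m → card (F (suc m)) ≡ card b * card (F m)) → ∀ m → card (F m) ≤ 18 ^ m * 4
    card-≤18 b F hb h0 hs zero = h0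
    card-≤18 b F hb h0 hs (suc m) = begin
      card (F (suc m)) ≡⟨ hs m ⟩
      card b * card (F m) ≤⟨ *-mono-≤ hb (card-≤18 b F hb h0 hs m) ⟩
      18 * (18 ^ m * 4) ≡⟨ P.sym (*-assoc 18 (18 ^ m) 4) ⟩
      18 ^ suc m * 4 ∎
      where open ≤-Reasoning

    card-Y : ∀ m → card (YIndex m) ≤ 18 ^ m * 4
    card-Y = card-≤18 YBlock YIndex (dec≤ _ _) card-vec-bool (λ m → P.refl)

    card-Z : ∀ m → card (ZIndex m) ≤ 18 ^ m * 4
    card-Z = card-≤18 ZBlock ZIndex (dec≤ _ _) card-vec-bool (λ m → P.refl)

    opCount-bound : ∀ m → opCount m + 79 * 18 ^ m ≤ 111 * 26 ^ m
    opCount-bound zero =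
      +-monoˡ-≤ 79 (≤-trans (*-mono-≤ card-vec-bool (*-monoˡ-≤ 2 (upTo2 {λ r → 2 ^ r ≤ 4} (dec≤ _ _) (dec≤ _ _) (dec≤ _ _) r hr)))
                     (dec≤ 32 32))
    opCount-bound (suc m) =
      level-step (card (XIndex m)) (card (YIndex m)) (card (ZIndex m)) (opCount m) (18 ^ m) (26 ^ m)
                 (card-X m) (card-Y m) (card-Z m) (opCount-bound m)

    -- tables of the X and Y values (products of ≤ dim m inputs), then the recursive circuit
    totalCost : ℕ → ℕ
    totalCost m = card (XIndex m ⊕c YIndex m) * dim m + opCount m

    totalCost-bound : ∀ m → totalCost m ≤ 176 * 26 ^ m
    totalCost-bound m =
      top-level (card (XIndex m)) (card (YIndex m)) (opCount m) m r (18 ^ m) (26 ^ m) (card-X m) (card-Y m) hr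
                (m*18^m≤26^m m) (^-monoˡ-≤ m (dec≤ 18 26)) (≤-trans (m≤m+n _ _) (opCount-bound m))

    cost-bound : ∀ m c → c ≤ totalCost m → c * 1000 ^ dim m ≤ 176000000 * 2985 ^ dim m
    cost-bound m c hc = begin
      c * 1000 ^ dim m ≤⟨ *-monoˡ-≤ (1000 ^ dim m) (≤-trans hc (totalCost-bound m)) ⟩
      176 * 26 ^ m * 1000 ^ dim m ≡⟨ *-assoc 176 (26 ^ m) _ ⟩
      176 * (26 ^ m * 1000 ^ dim m) ≤⟨ *-monoʳ-≤ 176 (26^m-to-2985 m r hr) ⟩
      176 * (1000000 * 2985 ^ dim m) ≡⟨ P.sym (*-assoc 176 1000000 (2985 ^ dim m)) ⟩
      176000000 * 2985 ^ dim m ∎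
      where open ≤-Reasoning

-- The whole circuit for n = 3m + r: tables of X (x) = ∏_{i ∈ T_X} f_i (S_X) and
-- Y (y) = ∏_{i ∈ T_Y} f_i (S_Y), then the recursive circuit for Bil m; for S ⊆ T
-- the two factors multiply to ∏_{i ∈ T} f_i (S), so Bil m X Y T is the transform.
module MultiSubsetCircuit {c ℓ : Level} (R : CommutativeRing c ℓ) (r : ℕ) (hr : r Data.Nat.≤ 2) where

  open CommutativeRing R hiding (zero)
  open import Data.Nat using (suc; _≤_; z≤n; s≤s; _^_) renaming (_*_ to _*ℕ_)
  import Data.Nat.Properties as ℕₚ
  open import Data.Fin using (Fin; zero; suc)
  open import Data.Fin.Subset using (Subset)
  open import Data.Vec using (Vec; []; _∷_)
  open import Data.Bool using (Bool; true; false)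
  open import Data.Product using (Σ; ∃-syntax; _×_; _,_)
  open import Data.Sum using (inj₁; inj₂)
  open import Data.Empty using (⊥)
  open import Function using (_∘_)
  open import Relation.Binary.PropositionalEquality as P using (_≡_)
  open import Relation.Binary.Reasoning.Setoid setoid
  open Semantics R using (prodOver; multiSubsetTransform; Computes)
  open FiniteIndex
  open SubsetSums R
  open Splitting
  open Levels r
  open BlockForm R r
  open Cost.Counts r hr using (totalCost; cost-bound)

  prodOver-merge : ∀ {k} {A B T : Vec Bool k} → Merge A B T → ∀ (h : Fin k → Carrier) →
                   prodOver A h * prodOver B h ≈ prodOver T h
  prodOver-merge mnil h = *-identityˡ 1#
  prodOver-merge (mff mg) h = prodOver-merge mg (h ∘ suc)
  prodOver-merge (mtf mg) h = trans (*-assoc _ _ _) (*-congˡ (prodOver-merge mg (h ∘ suc)))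
  prodOver-merge (mft {A = A} {B} {T} mg) h = begin
    prodOver A (h ∘ suc) * (h zero * prodOver B (h ∘ suc)) ≈⟨ x∙yz≈y∙xz _ _ _ ⟩
    h zero * (prodOver A (h ∘ suc) * prodOver B (h ∘ suc)) ≈⟨ *-congˡ (prodOver-merge mg (h ∘ suc)) ⟩
    h zero * prodOver T (h ∘ suc) ∎
    where open import Algebra.Properties.CommutativeSemigroup *-commutativeSemigroup using (x∙yz≈y∙xz)

  module Construction (m : ℕ) where
    open Circuits R (dim m)
    open Recursion R (dim m) r using (bilCircuit)

    productExpr : ∀ {k I} → Vec Bool k → (Fin k → Expr I) → Expr I
    productExpr [] h = oneE
    productExpr (true ∷ A) h = h zero ⊛ productExpr A (h ∘ suc)
    productExpr (false ∷ A) h = productExpr A (h ∘ suc)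

    productExpr-sem : ∀ {k I} (A : Vec Bool k) (h : Fin k → Expr I) f v →
                      ⟦ productExpr A h ⟧ f v ≡ prodOver A (λ i → ⟦ h i ⟧ f v)
    productExpr-sem [] h f v = P.refl
    productExpr-sem (true ∷ A) h f v = P.cong (⟦ h zero ⟧ f v *_) (productExpr-sem A (h ∘ suc) f v)
    productExpr-sem (false ∷ A) h f v = productExpr-sem A (h ∘ suc) f v

    productExpr-size : ∀ {k I} (A : Vec Bool k) (h : Fin k → Expr I) → (∀ i → size (h i) ≡ 0) →
                       size (productExpr A h) ≤ k
    productExpr-size [] h z = z≤n
    productExpr-size (true ∷ A) h z rewrite z zero = s≤s (productExpr-size A (h ∘ suc) (z ∘ suc))
    productExpr-size (false ∷ A) h z = ℕₚ.m≤n⇒m≤1+n (productExpr-size A (h ∘ suc) (z ∘ suc))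

    tableExpr : El (XIndex m ⊕c YIndex m) → Expr ⊥
    tableExpr (inj₁ x) = productExpr (TX m x) (λ i → inp i (SX m x))
    tableExpr (inj₂ y) = productExpr (TY m y) (λ i → inp i (SY m y))

    tableExpr-size : ∀ x → size (tableExpr x) ≤ dim m
    tableExpr-size (inj₁ x) = productExpr-size (TX m x) _ (λ i → P.refl)
    tableExpr-size (inj₂ y) = productExpr-size (TY m y) _ (λ i → P.refl)

    circuit : Circuit ⊥ (El (ZIndex m)) (totalCost m)
    circuit = seq (layer (XIndex m ⊕c YIndex m) tableExpr (dim m) tableExpr-size) (bilCircuit m)

    program : Extension [] (El (ZIndex m)) (totalCost m)
    program = extend circuit [] (λ ())

    module _ (f : Input) where
      X : El (XIndex m) → Carrier
      X x = prodOver (TX m x) (λ i → f i (SX m x))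

      Y : El (YIndex m) → Carrier
      Y y = prodOver (TY m y) (λ i → f i (SY m y))

      table-X : ∀ x → ⟦ tableExpr (inj₁ x) ⟧ f (λ ()) ≡ X x
      table-X x = productExpr-sem (TX m x) _ f (λ ())

      table-Y : ∀ y → ⟦ tableExpr (inj₂ y) ⟧ f (λ ()) ≡ Y y
      table-Y y = productExpr-sem (TY m y) _ f (λ ())

      factors : ∀ z S → S ⊆ᵥ setOf m z → X (xIndex m z S) * Y (yIndex m z S) ≈ prodOver (setOf m z) (λ i → f i S)
      factors z S h rewrite SX-xIndex m z S | SY-yIndex m z S = prodOver-merge (merge-index m z S h) (λ i → f i S)

      circuit-spec : ∀ T → spec circuit f (λ ()) (indexOf m T) ≈ multiSubsetTransform f T
      circuit-spec T = begin
        spec circuit f (λ ()) z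
          ≈⟨ Bil-closed m _ _ z ⟩
        Σ⊆ (setOf m z) (λ S → ⟦ tableExpr (inj₁ (xIndex m z S)) ⟧ f (λ ()) * ⟦ tableExpr (inj₂ (yIndex m z S)) ⟧ f (λ ()))
          ≈⟨ Σ⊆-cong (setOf m z) (λ S h →
               trans (reflexive (P.cong₂ _*_ (table-X (xIndex m z S)) (table-Y (yIndex m z S)))) (factors z S h)) ⟩
        Σ⊆ (setOf m z) (λ S → prodOver (setOf m z) (λ i → f i S))
          ≡⟨ P.cong (λ T′ → Σ⊆ T′ (λ S → prodOver T′ (λ i → f i S))) (setOf-indexOf m T) ⟩
        Σ⊆ T (λ S → prodOver T (λ i → f i S))
          ≈⟨ Σ⊆-subsetsOf T _ ⟩
        multiSubsetTransform f T ∎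
        where z = indexOf m T

    computes : Computes (prog program) (output program ∘ indexOf m)
    computes f T = trans (sound circuit [] (λ ()) f (λ ()) (λ ()) (indexOf m T)) (circuit-spec f T)

    cost-le-total : cost (prog program) ≤ totalCost m
    cost-le-total = ℕₚ.≤-trans (cost-le program) (ℕₚ.≤-reflexive (ℕₚ.+-identityʳ (totalCost m)))

  multiSubsetProgram : ∀ m → ∃[ k ] Σ (Prog (dim m) k) λ p → Σ (Subset (dim m) → Fin k) λ out →
                         Computes p out × cost p *ℕ 1000 ^ dim m ≤ 176000000 *ℕ 2985 ^ dim m
  multiSubsetProgram m = width program , prog program , output program ∘ indexOf m , computes
                       , cost-bound m (cost (prog program)) cost-le-total
    where
    open Construction m
    open Circuits R (dim m) using (width; prog; output)

open import Data.Nat using (_*_; _^_; _≤_; _+_; _/_; _%_)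
import Data.Nat.Properties as ℕₚ
open import Data.Nat.DivMod using (m≡m%n+[m/n]*n; m%n<n)
open import Data.Fin using (Fin)
open import Data.Fin.Subset using (Subset)
open import Data.Product using (∃-syntax; Σ; _×_; _,_)
open import Relation.Binary.PropositionalEquality as P using (_≡_)

theorem1 : ∀ {c ℓ : Level} (R : CommutativeRing c ℓ) →
    ∃[ C ] ∀ (n : ℕ) →
      ∃[ k ] Σ (Prog n k) λ p → Σ (Subset n → Fin k) λ out →
        Semantics.Computes R p out × cost p * 1000 ^ n ≤ C * 2985 ^ n
theorem1 R = 176000000 , λ n →
  P.subst (λ n → ∃[ k ] Σ (Prog n k) λ p → Σ (Subset n → Fin k) λ out →
                   Semantics.Computes R p out × cost p * 1000 ^ n ≤ 176000000 * 2985 ^ n)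
          (P.sym (n≡3q+r n))
          (MultiSubsetCircuit.multiSubsetProgram R (n % 3) (ℕₚ.≤-pred (m%n<n n 3)) (n / 3))
  where
  n≡3q+r : ∀ n → n ≡ (n / 3) * 3 + n % 3
  n≡3q+r n = P.trans (m≡m%n+[m/n]*n n 3) (ℕₚ.+-comm (n % 3) _)
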